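{- Let $Q\ge3$ and $r\ge1$. Suppose $a_1/q_1<a_2/q_2<\cdots<a_{r+1}/q_{r+1}$ are consecutive elements of $\mathcal F_Q$ (in lowest terms) with $a_1/q_1,\ a_{r+1}/q_{r+1}\in\mathfrak{SF}_Q$ and $a_2/q_2,\ldots,a_r/q_r\notin\mathfrak{SF}_Q$. For $2\le i\le r$ let $\nu_i:=\lfloor (Q+q_{i-1})/q_i\rfloor$. Then $K^F_{r-1}(\nu_2,\ldots,\nu_r)=1$.
   Context: $\mathcal F_Q:=\{d/b: 1\le d\le b\le Q,\ \gcd(d,b)=1\}$. For a reduced fraction $a/q\in(0,1]$ with $q\ge2$, $\bar a$ is the inverse of $a$ modulo $q$ in $[1,q)$ and $h(a/q):=q+a+\bar a$; $h(1/1):=3$; $\mathfrak{SF}_Q:=\{a/q\in\mathbb Q\cap(0,1]:h(a/q)\le Q\}$. The polynomials $K^F_\ell$ are defined by $K^F_{ -1}:=0$, $K^F_0:=1$ (empty argument list), $K^F_1(x)=x$, and $K^F_\ell(x_1,\ldots,x_\ell)=x_\ell K^F_{\ell-1}(x_1,\ldots,x_{\ell-1})-K^F_{\ell-2}(x_1,\ldots,x_{\ell-2})$. -}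

module Defs where

open import Data.Nat using (ℕ; zero; suc; _+_; _*_; _∸_; _≤_; _<_)
open import Data.Nat.DivMod using (_/_; _%_)
open import Data.Nat.Coprimality using (Coprime)
open import Data.Integer as ℤ using (ℤ)
open import Data.Product using (_×_; Σ)
open import Data.Sum using (_⊎_)
open import Relation.Binary.PropositionalEquality using (_≡_)
open import Relation.Nullary using (¬_)

InF : ℕ → ℕ → ℕ → Set
InF Q a q = (1 ≤ a) × (a ≤ q) × (q ≤ Q) × Coprime a q

_/_<ᶠ_/_ : ℕ → ℕ → ℕ → ℕ → Set
a / q <ᶠ b / s = a * s < b * q

ConsecutiveF : ℕ → ℕ → ℕ → ℕ → ℕ → Set
ConsecutiveF Q a q b s =
  (a / q <ᶠ b / s) ×
  ((c t : ℕ) → InF Q c t → ¬ ((a / q <ᶠ c / t) × (c / t <ᶠ b / s)))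

IsModInv : ℕ → ℕ → ℕ → Set
IsModInv a q abar = (1 ≤ abar) × (abar < q) × ((a * abar) % suc (q ∸ 1) ≡ 1)

-- h(a/q) ≤ Q, i.e. a/q ∈ SF_Q (for a reduced fraction a/q in (0,1]).
-- h(1/1) = 3; for q ≥ 2, h(a/q) = q + a + abar with abar the (unique) inverse.
InSF : ℕ → ℕ → ℕ → Set
InSF Q a q =
  ((a ≡ 1) × (q ≡ 1) × (3 ≤ Q)) ⊎
  ((2 ≤ q) × Σ ℕ (λ abar → IsModInv a q abar × (q + a + abar ≤ Q)))

-- Floor division (the divisor 0 case is never used: denominators are ≥ 1).
fdiv : ℕ → ℕ → ℕ
fdiv m zero    = 0
fdiv m (suc n) = m / suc n

-- K^F_ℓ(x_1,…,x_ℓ) with arguments given as a function x indexed from 1.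
KF : (ℕ → ℤ) → ℕ → ℤ
KF x zero = ℤ.+ 1
KF x (suc zero) = x 1
KF x (suc (suc l)) = x (suc (suc l)) ℤ.* KF x (suc l) ℤ.- KF x l

{-# OPTIONS --safe #-}
-- Call a/q < c/t adjacent when c q - a t = 1. Consecutive elements of F_Q are adjacent, and so are
-- consecutive elements of SF_Q. For the latter, write a ā = 1 + b q with ā the inverse of a modulo q:
-- then a/q is the mediant of the adjacent fractions b/ā and (a - b)/(q - ā), and h does not increase
-- from a fraction to either of these parents. If a/q < c/t are not adjacent, the right parent of a/q
-- or the left parent of c/t lies strictly between them, since otherwise the denominator bound
-- q + t ≤ y for x/y strictly between adjacent a/q < c/t would give both t > q and q > t. So between
-- two elements of SF_Q that are not adjacent lies a third, here necessarily some a_i with 2 ≤ i ≤ r.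
--
-- Three consecutive fractions of F_Q satisfy a₀ + a₂ = ν a₁ and q₀ + q₂ = ν q₁, with
-- ν = ⌊(Q + q₀)/q₁⌋ because 0 ≤ Q - q₂ < q₁ (the mediant of neighbours is not in F_Q). Hence the
-- determinants D_l = a_(l+1) q_1 - a_1 q_(l+1) start with 0, 1 and follow the recurrence of K^F, so
-- K^F_(r-1)(ν_2, …, ν_r) = D_r = 1 by adjacency of the two ends.
module Submission where

open import Defs
open import Data.Nat using (ℕ; zero; suc; _+_; _*_; _∸_; _≤_; _<_; z≤n; s≤s; NonZero; >-nonZero)
open import Data.Nat.Properties
open import Data.Nat.DivMod using (_%_; _/_; %-congˡ; [m+kn]%n≡m%n; m<n⇒m%n≡m; %-distribˡ-*; m%n%n≡m%n; m%n<n; m%n≤m; m%n≤n; m≡m%n+[m/n]*n; /-congˡ; +-distrib-/-∣ʳ; m<n⇒m/n≡0; m*n/n≡m)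
open import Data.Nat.Divisibility using (_∣_; divides; divides-refl; ∣1⇒≡1; ∣m+n∣m⇒∣n; ∣m⇒∣m*n; ∣n⇒∣m*n; n∣m*n; ∣-antisym)
open import Data.Nat.Coprimality using (Coprime; coprime-divisor; coprime-Bézout)
open import Data.Nat.GCD using (module Bézout)
import Data.Nat.Coprimality as Coprime
open import Data.Nat.Tactic.RingSolver using (solve)
open import Data.List using ([]; _∷_)
open import Data.Integer as ℤ using (ℤ; 0ℤ; 1ℤ)
import Data.Integer.Properties as ℤP
import Data.Integer.Tactic.RingSolver as ℤ-Solver
open import Data.Product using (∃; ∃₂; _×_; _,_; proj₁; proj₂)
open import Data.Sum using (_⊎_; inj₁; inj₂)
open import Data.Unit using (⊤; tt)
open import Data.Empty using (⊥-elim)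
open import Relation.Binary.Definitions using (tri<; tri≈; tri>)
open import Relation.Binary.PropositionalEquality
open import Relation.Nullary using (¬_; yes; no)

-- Adjacent fractions

record Adjacent (a q c t : ℕ) : Set where
  constructor adjacent
  field
    cq≡1+at : c * q ≡ suc (a * t)

adjacent⇒<ᶠ : ∀ {a q c t} → Adjacent a q c t → a / q <ᶠ c / t
adjacent⇒<ᶠ (adjacent cq≡1+at) = ≤-reflexive (sym cq≡1+at)

adjacent⇒1≤q : ∀ {a q c t} → Adjacent a q c t → 1 ≤ q
adjacent⇒1≤q {q = zero} {c = c} (adjacent cq≡1+at) with () ← trans (sym (*-zeroʳ c)) cq≡1+at
adjacent⇒1≤q {q = suc _} _ = s≤s z≤n

adjacent⇒1≤c : ∀ {a q c t} → Adjacent a q c t → 1 ≤ c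
adjacent⇒1≤c {c = zero} (adjacent ())
adjacent⇒1≤c {c = suc _} _ = s≤s z≤n

adjacent⇒a<c : ∀ {a q c t} → Adjacent a q c t → q ≤ t → a < c
adjacent⇒a<c {a} {q} {c} {t} adj q≤t = *-cancelʳ-< t a c (begin-strict
  a * t  <⟨ adjacent⇒<ᶠ adj ⟩
  c * q  ≤⟨ *-monoʳ-≤ c q≤t ⟩
  c * t  ∎)
  where open ≤-Reasoning

adjacent⇒a<q : ∀ {a q c t} → Adjacent a q c t → c ≤ t → a < q
adjacent⇒a<q {a} {q} {c} {t} adj c≤t = *-cancelʳ-< t a q (begin-strict
  a * t  <⟨ adjacent⇒<ᶠ adj ⟩
  c * q  ≤⟨ *-monoˡ-≤ q c≤t ⟩
  t * q  ≡⟨ *-comm t q ⟩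
  q * t  ∎)
  where open ≤-Reasoning

adjacent⇒c≤t : ∀ {a q c t} → Adjacent a q c t → a ≤ q → 1 < q → c ≤ t
adjacent⇒c≤t {a} {q} {c} {t} (adjacent cq≡1+at) a≤q 1<q = ≤-pred (*-cancelʳ-< q c (suc t) (begin-strict
  c * q         ≡⟨ cq≡1+at ⟩
  suc (a * t)   ≤⟨ s≤s (*-monoˡ-≤ t a≤q) ⟩
  suc (q * t)   <⟨ +-monoˡ-< (q * t) 1<q ⟩
  q + q * t     ≡⟨ cong (q +_) (*-comm q t) ⟩
  suc t * q     ∎))
  where open ≤-Reasoning

adjacent⇒coprimeˡ : ∀ {a q c t} → Adjacent a q c t → Coprime a q
adjacent⇒coprimeˡ {a} {q} {c} {t} (adjacent cq≡1+at) {i} (i∣a , i∣q) =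
  ∣1⇒≡1 (∣m+n∣m⇒∣n (subst (i ∣_) (trans cq≡1+at (+-comm 1 (a * t))) (∣n⇒∣m*n c i∣q)) (∣m⇒∣m*n t i∣a))

adjacent⇒coprimeʳ : ∀ {a q c t} → Adjacent a q c t → Coprime c t
adjacent⇒coprimeʳ {a} {q} {c} {t} (adjacent cq≡1+at) {i} (i∣c , i∣t) =
  ∣1⇒≡1 (∣m+n∣m⇒∣n (subst (i ∣_) (trans cq≡1+at (+-comm 1 (a * t))) (∣m⇒∣m*n q i∣c)) (∣n⇒∣m*n a i∣t))

reduced-cross-≡ : ∀ {a q c t} → Coprime a q → Coprime c t → 1 ≤ t → a * t ≡ c * q → a ≡ c × q ≡ t
reduced-cross-≡ {a} {q} {c} {t} cop-aq cop-ct 1≤t at≡cq = a≡c , q≡t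
  where
  q≡t : q ≡ t
  q≡t = ∣-antisym (coprime-divisor (Coprime.sym cop-aq) (subst (q ∣_) (sym at≡cq) (n∣m*n c)))
                  (coprime-divisor (Coprime.sym cop-ct) (subst (t ∣_) at≡cq (n∣m*n a)))
  a≡c : a ≡ c
  a≡c = *-cancelʳ-≡ a c t {{>-nonZero 1≤t}} (trans at≡cq (cong (c *_) q≡t))

<ᶠ-trans : ∀ {a q b s c t} → 1 ≤ q → 1 ≤ s → a / q <ᶠ b / s → b / s <ᶠ c / t → a / q <ᶠ c / t
<ᶠ-trans {a} {q} {b} {s} {c} {t} 1≤q 1≤s a/q<b/s b/s<c/t = *-cancelʳ-< s (a * t) (c * q) (begin-strict
  a * t * s ≡⟨ solve (a ∷ t ∷ s ∷ []) ⟩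
  a * s * t ≤⟨ *-monoˡ-≤ t (<⇒≤ a/q<b/s) ⟩
  b * q * t ≡⟨ solve (b ∷ q ∷ t ∷ []) ⟩
  b * t * q <⟨ *-monoˡ-< q {{>-nonZero 1≤q}} b/s<c/t ⟩
  c * s * q ≡⟨ solve (c ∷ s ∷ q ∷ []) ⟩
  c * q * s ∎)
  where open ≤-Reasoning

mediant-adjacentˡ : ∀ {a q c t} → Adjacent a q c t → Adjacent a q (a + c) (q + t)
mediant-adjacentˡ {a} {q} {c} {t} (adjacent cq≡1+at) = adjacent (begin
  (a + c) * q       ≡⟨ solve (a ∷ c ∷ q ∷ []) ⟩
  a * q + c * q     ≡⟨ cong (a * q +_) cq≡1+at ⟩
  a * q + suc (a * t) ≡⟨ solve (a ∷ q ∷ t ∷ []) ⟩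
  suc (a * (q + t)) ∎)
  where open ≡-Reasoning

mediant-adjacentʳ : ∀ {a q c t} → Adjacent a q c t → Adjacent (a + c) (q + t) c t
mediant-adjacentʳ {a} {q} {c} {t} (adjacent cq≡1+at) = adjacent (begin
  c * (q + t)         ≡⟨ solve (c ∷ q ∷ t ∷ []) ⟩
  c * q + c * t       ≡⟨ cong (_+ c * t) cq≡1+at ⟩
  suc (a * t + c * t) ≡⟨ solve (a ∷ t ∷ c ∷ []) ⟩
  suc ((a + c) * t)   ∎)
  where open ≡-Reasoning

mediant-adjacentˡ⇒adjacent : ∀ {a q c t} → Adjacent a q (a + c) (q + t) → Adjacent a q c t
mediant-adjacentˡ⇒adjacent {a} {q} {c} {t} (adjacent [a+c]q≡1+a[q+t]) =
  adjacent (+-cancelˡ-≡ (a * q) (c * q) (suc (a * t)) (begin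
  a * q + c * q         ≡⟨ solve (a ∷ q ∷ c ∷ []) ⟩
  (a + c) * q           ≡⟨ [a+c]q≡1+a[q+t] ⟩
  suc (a * (q + t))     ≡⟨ solve (a ∷ q ∷ t ∷ []) ⟩
  a * q + suc (a * t)   ∎))
  where open ≡-Reasoning

-- y = q (c y - x t) + t (x q - a y), and both brackets are positive.
between-adjacent⇒q+t≤y : ∀ {a q c t x y} → Adjacent a q c t → a / q <ᶠ x / y → x / y <ᶠ c / t → q + t ≤ y
between-adjacent⇒q+t≤y {a} {q} {c} {t} {x} {y} (adjacent cq≡1+at) a/q<x/y x/y<c/t
  with u , a*y+u≡x*q ← m≤n⇒∃[o]m+o≡n a/q<x/y
     | w , x*t+w≡c*y ← m≤n⇒∃[o]m+o≡n x/y<c/t =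
  subst (q + t ≤_) (sym y≡q[1+w]+t[1+u]) (+-mono-≤ (m≤m*n q (suc w)) (m≤m*n t (suc u)))
  where
  open ≡-Reasoning
  y≡q[1+w]+t[1+u] : y ≡ q * suc w + t * suc u
  y≡q[1+w]+t[1+u] = +-cancelʳ-≡ (y * (a * t)) y _ (begin
    y + y * (a * t)                     ≡⟨ solve (y ∷ a ∷ t ∷ []) ⟩
    y * suc (a * t)                     ≡⟨ cong (y *_) cq≡1+at ⟨
    y * (c * q)                         ≡⟨ solve (y ∷ c ∷ q ∷ []) ⟩
    q * (c * y)                         ≡⟨ cong (q *_) x*t+w≡c*y ⟨
    q * (suc (x * t) + w)               ≡⟨ solve (q ∷ x ∷ t ∷ w ∷ []) ⟩
    q * suc w + t * (x * q)             ≡⟨ cong (λ z → q * suc w + t * z) a*y+u≡x*q ⟨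
    q * suc w + t * (suc (a * y) + u)   ≡⟨ solve (q ∷ w ∷ t ∷ a ∷ y ∷ u ∷ []) ⟩
    q * suc w + t * suc u + y * (a * t) ∎)

<ᶠ⇒1≤numerator : ∀ {a q c t} → a / q <ᶠ c / t → 1 ≤ c
<ᶠ⇒1≤numerator {c = zero} ()
<ᶠ⇒1≤numerator {c = suc _} _ = s≤s z≤n

compare-reduced : ∀ {a q c t} → Coprime a q → Coprime c t → 1 ≤ t →
                  a / q <ᶠ c / t ⊎ (a ≡ c × q ≡ t) ⊎ c / t <ᶠ a / q
compare-reduced {a} {q} {c} {t} cop-aq cop-ct 1≤t with <-cmp (a * t) (c * q)
... | tri< a/q<c/t _ _ = inj₁ a/q<c/t
... | tri≈ _ at≡cq _   = inj₂ (inj₁ (reduced-cross-≡ cop-aq cop-ct 1≤t at≡cq))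
... | tri> _ _ c/t<a/q = inj₂ (inj₂ c/t<a/q)

-- Inverses modulo q

[1+kq]%q≡1 : ∀ k {q} .{{_ : NonZero q}} → 1 < q → suc (k * q) % q ≡ 1
[1+kq]%q≡1 k {q} 1<q = trans ([m+kn]%n≡m%n 1 k q) (m<n⇒m%n≡m 1<q)

%≡1⇒isModInv : ∀ {q a y} .{{_ : NonZero q}} → (a * y) % q ≡ 1 → IsModInv a q (y % q)
%≡1⇒isModInv {q@(suc _)} {a} {y} ay%q≡1 = 1≤y%q , m%n<n y q , a[y%q]%q≡1
  where
  open ≡-Reasoning
  a[y%q]%q≡1 : (a * (y % q)) % q ≡ 1
  a[y%q]%q≡1 = begin
    (a * (y % q)) % q             ≡⟨ %-distribˡ-* a (y % q) q ⟩
    ((a % q) * (y % q % q)) % q   ≡⟨ cong (λ z → ((a % q) * z) % q) (m%n%n≡m%n y q) ⟩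
    ((a % q) * (y % q)) % q       ≡⟨ %-distribˡ-* a y q ⟨
    (a * y) % q                   ≡⟨ ay%q≡1 ⟩
    1                             ∎
  1≤y%q : 1 ≤ y % q
  1≤y%q with y % q | a[y%q]%q≡1
  ... | zero  | a*0%q≡1 with () ← trans (cong (_% q) (sym (*-zeroʳ a))) a*0%q≡1
  ... | suc _ | _ = s≤s z≤n

-- -x is an inverse of a modulo q, written x (q - 1) to stay in ℕ.
negated-inverse : ∀ {q x a y} .{{_ : NonZero q}} → 1 < q → suc (x * a) ≡ y * q → (a * (x * (q ∸ 1))) % q ≡ 1
negated-inverse {q@(suc q₁)} {x} {a} {y} 1<q 1+xa≡yq = begin
  (a * (x * q₁)) % q          ≡⟨ [m+kn]%n≡m%n (a * (x * q₁)) y q ⟨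
  (a * (x * q₁) + y * q) % q  ≡⟨ %-congˡ a[xq₁]+yq≡1+xaq ⟩
  suc (x * a * q) % q         ≡⟨ [1+kq]%q≡1 (x * a) 1<q ⟩
  1                           ∎
  where
  open ≡-Reasoning
  a[xq₁]+yq≡1+xaq : a * (x * q₁) + y * q ≡ suc (x * a * q)
  a[xq₁]+yq≡1+xaq = begin
    a * (x * q₁) + y * q        ≡⟨ cong (a * (x * q₁) +_) 1+xa≡yq ⟨
    a * (x * q₁) + suc (x * a)  ≡⟨ solve (a ∷ x ∷ q₁ ∷ []) ⟩
    suc (x * a * q)             ∎

coprime⇒isModInv : ∀ {q a} → 1 < q → Coprime a q → ∃ (IsModInv a q)
coprime⇒isModInv {q@(suc (suc _))} {a} 1<q@(s≤s (s≤s z≤n)) cop with coprime-Bézout cop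
... | Bézout.+- x y 1+yq≡xa =
  x % q , %≡1⇒isModInv {a = a} {y = x} (trans (%-congˡ (trans (*-comm a x) (sym 1+yq≡xa))) ([1+kq]%q≡1 y 1<q))
... | Bézout.-+ x y 1+xa≡yq =
  x * (q ∸ 1) % q , %≡1⇒isModInv {a = a} {y = x * (q ∸ 1)} (negated-inverse {x = x} {a = a} {y = y} 1<q 1+xa≡yq)

isModInv⇒adjacent : ∀ {a q s} → IsModInv a q s → ∃ λ b → Adjacent b s a q
isModInv⇒adjacent {a} {q} {s} (_ , s≤s _ , as%q≡1) =
  (a * s) / q , adjacent (trans (m≡m%n+[m/n]*n (a * s) q) (cong (_+ (a * s) / q * q) as%q≡1))

-- Stern–Brocot parents

-- The denominator s of the left parent is the inverse of a modulo q.
data Parents : ℕ → ℕ → ℕ → Set where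
  parents : ∀ {b s c t} → Adjacent b s c t → Parents (b + c) (s + t) s

left-adjacent⇒parents : ∀ {b s a q} → s < q → Adjacent b s a q → Parents a q s
left-adjacent⇒parents {b} {s} {a} {q} s<q adj
  with c , refl ← m≤n⇒∃[o]m+o≡n {b} {a} (<⇒≤ (adjacent⇒a<c adj (<⇒≤ s<q)))
     | t , refl ← m≤n⇒∃[o]m+o≡n {s} {q} (<⇒≤ s<q) = parents (mediant-adjacentˡ⇒adjacent adj)

isModInv⇒parents : ∀ {a q s} → IsModInv a q s → Parents a q s
isModInv⇒parents inv@(_ , s<q , _) = left-adjacent⇒parents s<q (proj₂ (isModInv⇒adjacent inv))

right-parent∈SF : ∀ {Q b s c t} → 3 ≤ Q → InF Q c t → Adjacent b s c t → s + t + (b + c) + s ≤ Q → InSF Q c t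
right-parent∈SF {t = zero} _ (1≤c , c≤0 , _) _ _ = ⊥-elim (<⇒≱ 1≤c c≤0)
right-parent∈SF {t = suc zero} 3≤Q (1≤c , c≤1 , _) _ _ = inj₁ (≤-antisym c≤1 1≤c , refl , 3≤Q)
right-parent∈SF {b = b} {s} {c} {t@(suc (suc _))} _ _ (adjacent cs≡1+bt) h[a/q]≤Q =
  inj₂ (s≤s (s≤s z≤n) , s % t , inverse , ≤-trans h[c/t]≤h[a/q] h[a/q]≤Q)
  where
  inverse : IsModInv c t (s % t)
  inverse = %≡1⇒isModInv {a = c} {y = s} (trans (%-congˡ cs≡1+bt) ([1+kq]%q≡1 b (s≤s (s≤s z≤n))))
  h[c/t]≤h[a/q] : t + c + s % t ≤ s + t + (b + c) + s
  h[c/t]≤h[a/q] = +-mono-≤ (+-mono-≤ (m≤n+m t s) (m≤n+m c b)) (m%n≤m s t)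

right-parent : ∀ {Q a q s} → InF Q a q → 1 < q → IsModInv a q s →
               ∃₂ λ c t → Adjacent a q c t × InF Q c t × (3 ≤ Q → q + a + s ≤ Q → InSF Q c t)
right-parent {Q} {a} {q} {s} (_ , a≤q , q≤Q , _) 1<q inv with isModInv⇒parents {a} {q} {s} inv
... | parents {b} {_} {c} {t} adj =
  c , t , mediant-adjacentʳ adj , c/t∈F , λ 3≤Q → right-parent∈SF 3≤Q c/t∈F adj
  where
  c/t∈F : InF Q c t
  c/t∈F = adjacent⇒1≤c adj , adjacent⇒c≤t (mediant-adjacentʳ adj) a≤q 1<q ,
          ≤-trans (m≤n+m t s) q≤Q , adjacent⇒coprimeʳ adj

left-parent∈F : ∀ {Q b s c t} → InF Q c t → s < t → Adjacent b s c t → 1 ≤ b → InF Q b s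
left-parent∈F (_ , c≤t , t≤Q , _) s<t adj 1≤b =
  1≤b , <⇒≤ (adjacent⇒a<q adj c≤t) , ≤-trans (<⇒≤ s<t) t≤Q , adjacent⇒coprimeˡ adj

left-parent∈SF : ∀ {Q b s c t} → InF Q c t → s < t → Adjacent b s c t → 1 ≤ b → t + c + s ≤ Q → InSF Q b s
left-parent∈SF {s = zero} _ _ adj _ _ = ⊥-elim (<⇒≱ (adjacent⇒1≤q adj) z≤n)
left-parent∈SF {b = b} {suc zero} {c} {t} (_ , c≤t , _) _ (adjacent c*1≡1+bt) 1≤b _ = ⊥-elim (<-irrefl refl c<c)
  where
  open ≤-Reasoning
  c<c : c < c
  c<c = begin-strict
    c            ≤⟨ c≤t ⟩
    t            ≤⟨ m≤n*m t b {{>-nonZero 1≤b}} ⟩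
    b * t        <⟨ n<1+n (b * t) ⟩
    suc (b * t)  ≡⟨ c*1≡1+bt ⟨
    c * 1        ≡⟨ *-identityʳ c ⟩
    c            ∎
left-parent∈SF {b = b} {s@(suc (suc _))} {c} {t} _ s<t adj@(adjacent cs≡1+bt) _ h[c/t]≤Q =
  inj₂ (s≤s (s≤s z≤n) , t * (s ∸ 1) % s , inverse , ≤-trans h[b/s]≤h[c/t] h[c/t]≤Q)
  where
  inverse : IsModInv b s (t * (s ∸ 1) % s)
  inverse = %≡1⇒isModInv {a = b} {y = t * (s ∸ 1)}
    (negated-inverse {x = t} {a = b} {y = c} (s≤s (s≤s z≤n)) (trans (cong suc (*-comm t b)) (sym cs≡1+bt)))
  h[b/s]≤h[c/t] : s + b + t * (s ∸ 1) % s ≤ t + c + s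
  h[b/s]≤h[c/t] = +-mono-≤ (+-mono-≤ (<⇒≤ s<t) (<⇒≤ (adjacent⇒a<c adj (<⇒≤ s<t)))) (m%n≤n (t * (s ∸ 1)) s)

left-parent : ∀ {Q c t s} → InF Q c t → IsModInv c t s →
              ∃ λ b → Adjacent b s c t × (1 ≤ b → InF Q b s × (t + c + s ≤ Q → InSF Q b s))
left-parent c/t∈F inv@(_ , s<t , _) with b , adj ← isModInv⇒adjacent inv =
  b , adj , λ 1≤b → left-parent∈F c/t∈F s<t adj 1≤b , left-parent∈SF c/t∈F s<t adj 1≤b

-- Neighbours in F_Q and SF_Q

∈F⇒1≤q : ∀ {Q a q} → InF Q a q → 1 ≤ q
∈F⇒1≤q (1≤a , a≤q , _) = ≤-trans 1≤a a≤q

∈F⇒coprime : ∀ {Q a q} → InF Q a q → Coprime a q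
∈F⇒coprime (_ , _ , _ , cop) = cop

<ᶠ⇒1<q : ∀ {Q a q c t} → InF Q a q → InF Q c t → a / q <ᶠ c / t → 1 < q
<ᶠ⇒1<q {q = zero} (1≤a , a≤0 , _) _ _ = ⊥-elim (<⇒≱ 1≤a a≤0)
<ᶠ⇒1<q {a = a} {suc zero} {c} {t} (1≤a , _) (_ , c≤t , _) a/1<c/t = ⊥-elim (<⇒≱ c>t c≤t)
  where
  open ≤-Reasoning
  c>t : t < c
  c>t = begin-strict
    t      ≤⟨ m≤n*m t a {{>-nonZero 1≤a}} ⟩
    a * t  <⟨ a/1<c/t ⟩
    c * 1  ≡⟨ *-identityʳ c ⟩
    c      ∎
<ᶠ⇒1<q {q = suc (suc _)} _ _ _ = s≤s (s≤s z≤n)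

adjacent-trichotomyʳ : ∀ {a q c₀ t₀ c t} → Adjacent a q c₀ t₀ → Coprime c t → 1 ≤ t → a / q <ᶠ c / t →
                       c₀ / t₀ <ᶠ c / t ⊎ Adjacent a q c t ⊎ q + t₀ ≤ t
adjacent-trichotomyʳ {c = c} {t} adj cop-ct 1≤t a/q<c/t with compare-reduced (adjacent⇒coprimeʳ adj) cop-ct 1≤t
... | inj₁ c₀/t₀<c/t          = inj₁ c₀/t₀<c/t
... | inj₂ (inj₁ (refl , refl)) = inj₂ (inj₁ adj)
... | inj₂ (inj₂ c/t<c₀/t₀)   = inj₂ (inj₂ (between-adjacent⇒q+t≤y {x = c} {t} adj a/q<c/t c/t<c₀/t₀))

adjacent-trichotomyˡ : ∀ {b s c t a q} → Adjacent b s c t → Coprime a q → a / q <ᶠ c / t →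
                       a / q <ᶠ b / s ⊎ Adjacent a q c t ⊎ s + t ≤ q
adjacent-trichotomyˡ {a = a} {q} adj cop-aq a/q<c/t with compare-reduced cop-aq (adjacent⇒coprimeˡ adj) (adjacent⇒1≤q adj)
... | inj₁ a/q<b/s            = inj₁ a/q<b/s
... | inj₂ (inj₁ (refl , refl)) = inj₂ (inj₁ adj)
... | inj₂ (inj₂ b/s<a/q)     = inj₂ (inj₂ (between-adjacent⇒q+t≤y {x = a} {q} adj b/s<a/q a/q<c/t))

record Between (Q : ℕ) (P : ℕ → ℕ → Set) (a q c t : ℕ) : Set where
  constructor between
  field
    x y     : ℕ
    x/y∈F   : InF Q x y
    P[x/y]  : P x y
    a/q<x/y : a / q <ᶠ x / y
    x/y<c/t : x / y <ᶠ c / t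

RightCandidate : ℕ → (ℕ → ℕ → Set) → ℕ → ℕ → Set
RightCandidate Q P a q = ∃₂ λ c t → Adjacent a q c t × InF Q c t × P c t

LeftCandidate : ℕ → (ℕ → ℕ → Set) → ℕ → ℕ → Set
LeftCandidate Q P c t = ∃₂ λ b s → Adjacent b s c t × (1 ≤ b → InF Q b s × P b s)

adjacent-or-between : ∀ {Q a q c t} (P : ℕ → ℕ → Set) → InF Q a q → InF Q c t → a / q <ᶠ c / t →
                      RightCandidate Q P a q → (1 < t → LeftCandidate Q P c t) →
                      Adjacent a q c t ⊎ Between Q P a q c t
adjacent-or-between {Q} {a} {q} {c} {t} P a/q∈F@(_ , _ , _ , cop-aq) c/t∈F@(_ , _ , _ , cop-ct) a/q<c/t
                    (c₀ , t₀ , adj₀ , c₀/t₀∈F , P₀) left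
  with adjacent-trichotomyʳ adj₀ cop-ct (∈F⇒1≤q c/t∈F) a/q<c/t
... | inj₁ c₀/t₀<c/t = inj₂ (between c₀ t₀ c₀/t₀∈F P₀ (adjacent⇒<ᶠ adj₀) c₀/t₀<c/t)
... | inj₂ (inj₁ adj) = inj₁ adj
... | inj₂ (inj₂ q+t₀≤t) with left (≤-trans (+-mono-≤ (∈F⇒1≤q a/q∈F) (∈F⇒1≤q c₀/t₀∈F)) q+t₀≤t)
...   | b , s , adj₁ , b/s∈F with adjacent-trichotomyˡ adj₁ cop-aq a/q<c/t
...     | inj₁ a/q<b/s with b/s∈F , P₁ ← b/s∈F (<ᶠ⇒1≤numerator {a} {q} {b} {s} a/q<b/s) =
  inj₂ (between b s b/s∈F P₁ a/q<b/s (adjacent⇒<ᶠ adj₁))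
...     | inj₂ (inj₁ adj) = inj₁ adj
...     | inj₂ (inj₂ s+t≤q) = ⊥-elim (<-irrefl refl (begin-strict
  t       ≤⟨ m≤n+m t s ⟩
  s + t   ≤⟨ s+t≤q ⟩
  q       <⟨ m<m+n q (∈F⇒1≤q c₀/t₀∈F) ⟩
  q + t₀  ≤⟨ q+t₀≤t ⟩
  t       ∎))
  where open ≤-Reasoning

farey-right-candidate : ∀ {Q a q} → InF Q a q → 1 < q → RightCandidate Q (λ _ _ → ⊤) a q
farey-right-candidate a/q∈F@(_ , _ , _ , cop-aq) 1<q
  with _ , inv ← coprime⇒isModInv 1<q cop-aq
  with c , t , adj , c/t∈F , _ ← right-parent a/q∈F 1<q inv = c , t , adj , c/t∈F , tt

farey-left-candidate : ∀ {Q c t} → InF Q c t → 1 < t → LeftCandidate Q (λ _ _ → ⊤) c t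
farey-left-candidate c/t∈F@(_ , _ , _ , cop-ct) 1<t
  with s , inv ← coprime⇒isModInv 1<t cop-ct
  with b , adj , b/s∈F ← left-parent c/t∈F inv = b , s , adj , λ 1≤b → proj₁ (b/s∈F 1≤b) , tt

sf-right-candidate : ∀ {Q a q} → 3 ≤ Q → InF Q a q → 1 < q → InSF Q a q → RightCandidate Q (InSF Q) a q
sf-right-candidate _ _ (s≤s ()) (inj₁ (_ , refl , _))
sf-right-candidate 3≤Q a/q∈F 1<q (inj₂ (_ , s , inv , h[a/q]≤Q))
  with c , t , adj , c/t∈F , c/t∈SF ← right-parent a/q∈F 1<q inv = c , t , adj , c/t∈F , c/t∈SF 3≤Q h[a/q]≤Q

sf-left-candidate : ∀ {Q c t} → InF Q c t → 1 < t → InSF Q c t → LeftCandidate Q (InSF Q) c t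
sf-left-candidate _ (s≤s ()) (inj₁ (_ , refl , _))
sf-left-candidate c/t∈F 1<t (inj₂ (_ , s , inv , h[c/t]≤Q))
  with b , adj , b/s∈F ← left-parent c/t∈F inv =
  b , s , adj , λ 1≤b → proj₁ (b/s∈F 1≤b) , proj₂ (b/s∈F 1≤b) h[c/t]≤Q

consecutive⇒adjacent : ∀ {Q a q c t} → InF Q a q → InF Q c t → ConsecutiveF Q a q c t → Adjacent a q c t
consecutive⇒adjacent a/q∈F c/t∈F (a/q<c/t , nothing-between)
  with adjacent-or-between _ a/q∈F c/t∈F a/q<c/t
         (farey-right-candidate a/q∈F (<ᶠ⇒1<q a/q∈F c/t∈F a/q<c/t)) (farey-left-candidate c/t∈F)
... | inj₁ adj = adj
... | inj₂ (between x y x/y∈F _ a/q<x/y x/y<c/t) = ⊥-elim (nothing-between x y x/y∈F (a/q<x/y , x/y<c/t))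

sf-adjacent-or-between : ∀ {Q a q c t} → 3 ≤ Q → InF Q a q → InF Q c t → InSF Q a q → InSF Q c t →
                         a / q <ᶠ c / t → Adjacent a q c t ⊎ Between Q (InSF Q) a q c t
sf-adjacent-or-between 3≤Q a/q∈F c/t∈F a/q∈SF c/t∈SF a/q<c/t =
  adjacent-or-between _ a/q∈F c/t∈F a/q<c/t
    (sf-right-candidate 3≤Q a/q∈F (<ᶠ⇒1<q a/q∈F c/t∈F a/q<c/t) a/q∈SF)
    (λ 1<t → sf-left-candidate c/t∈F 1<t c/t∈SF)

-- The three-term recurrence

adjacent-triple⇒a₁[q₀+q₂]≡q₁[a₀+a₂] : ∀ {a₀ q₀ a₁ q₁ a₂ q₂} → Adjacent a₀ q₀ a₁ q₁ → Adjacent a₁ q₁ a₂ q₂ →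
                        a₁ * (q₀ + q₂) ≡ q₁ * (a₀ + a₂)
adjacent-triple⇒a₁[q₀+q₂]≡q₁[a₀+a₂] {a₀} {q₀} {a₁} {q₁} {a₂} {q₂} (adjacent a₁q₀≡1+a₀q₁) (adjacent a₂q₁≡1+a₁q₂) = begin
  a₁ * (q₀ + q₂)            ≡⟨ *-distribˡ-+ a₁ q₀ q₂ ⟩
  a₁ * q₀ + a₁ * q₂         ≡⟨ cong (_+ a₁ * q₂) a₁q₀≡1+a₀q₁ ⟩
  suc (a₀ * q₁) + a₁ * q₂   ≡⟨ solve (a₀ ∷ q₁ ∷ a₁ ∷ q₂ ∷ []) ⟩
  a₀ * q₁ + suc (a₁ * q₂)   ≡⟨ cong (a₀ * q₁ +_) a₂q₁≡1+a₁q₂ ⟨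
  a₀ * q₁ + a₂ * q₁         ≡⟨ solve (a₀ ∷ q₁ ∷ a₂ ∷ []) ⟩
  q₁ * (a₀ + a₂)            ∎
  where open ≡-Reasoning

adjacent-triple⇒recurrence : ∀ {a₀ q₀ a₁ q₁ a₂ q₂} → Adjacent a₀ q₀ a₁ q₁ → Adjacent a₁ q₁ a₂ q₂ →
                             ∃ λ k → a₀ + a₂ ≡ k * a₁ × q₀ + q₂ ≡ k * q₁
adjacent-triple⇒recurrence {a₀} {q₀} {a₁} {q₁} {a₂} {q₂} adj₀₁ adj₁₂
  with divides k q₀+q₂≡kq₁ ← coprime-divisor (Coprime.sym (adjacent⇒coprimeʳ adj₀₁))
                               (divides (a₀ + a₂) (trans (adjacent-triple⇒a₁[q₀+q₂]≡q₁[a₀+a₂] adj₀₁ adj₁₂) (*-comm q₁ (a₀ + a₂)))) =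
  k , *-cancelʳ-≡ (a₀ + a₂) (k * a₁) q₁ {{>-nonZero (adjacent⇒1≤q adj₁₂)}} [a₀+a₂]q₁≡ka₁q₁ , q₀+q₂≡kq₁
  where
  open ≡-Reasoning
  [a₀+a₂]q₁≡ka₁q₁ : (a₀ + a₂) * q₁ ≡ k * a₁ * q₁
  [a₀+a₂]q₁≡ka₁q₁ = begin
    (a₀ + a₂) * q₁   ≡⟨ *-comm (a₀ + a₂) q₁ ⟩
    q₁ * (a₀ + a₂)   ≡⟨ adjacent-triple⇒a₁[q₀+q₂]≡q₁[a₀+a₂] adj₀₁ adj₁₂ ⟨
    a₁ * (q₀ + q₂)   ≡⟨ cong (a₁ *_) q₀+q₂≡kq₁ ⟩
    a₁ * (k * q₁)    ≡⟨ solve (a₁ ∷ k ∷ q₁ ∷ []) ⟩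
    k * a₁ * q₁      ∎

consecutive⇒Q<q+t : ∀ {Q a q c t} → InF Q a q → InF Q c t → ConsecutiveF Q a q c t → Q < q + t
consecutive⇒Q<q+t {Q} {a} {q} {c} {t} a/q∈F@(1≤a , a≤q , _) c/t∈F@(_ , c≤t , _) consec@(_ , nothing-between)
  with q + t ≤? Q
... | no q+t≰Q = ≰⇒> q+t≰Q
... | yes q+t≤Q = ⊥-elim (nothing-between (a + c) (q + t) mediant∈F
                            (adjacent⇒<ᶠ (mediant-adjacentˡ adj) , adjacent⇒<ᶠ (mediant-adjacentʳ adj)))
  where
  adj = consecutive⇒adjacent a/q∈F c/t∈F consec
  mediant∈F : InF Q (a + c) (q + t)
  mediant∈F = ≤-trans 1≤a (m≤m+n a c) , +-mono-≤ a≤q c≤t , q+t≤Q , adjacent⇒coprimeʳ (mediant-adjacentˡ adj)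

⌊Q+q₀/q₁⌋≡k : ∀ {Q q₀ q₁ q₂ k} → 1 ≤ q₁ → q₂ ≤ Q → Q < q₁ + q₂ → q₀ + q₂ ≡ k * q₁ → fdiv (Q + q₀) q₁ ≡ k
⌊Q+q₀/q₁⌋≡k {Q} {q₀} {q₁@(suc _)} {q₂} {k} _ q₂≤Q Q<q₁+q₂ q₀+q₂≡kq₁ = begin
  (Q + q₀) / q₁                 ≡⟨ /-congˡ Q+q₀≡[Q∸q₂]+kq₁ ⟩
  (Q ∸ q₂ + k * q₁) / q₁        ≡⟨ +-distrib-/-∣ʳ (Q ∸ q₂) (divides-refl k) ⟩
  (Q ∸ q₂) / q₁ + k * q₁ / q₁   ≡⟨ cong₂ _+_ (m<n⇒m/n≡0 Q∸q₂<q₁) (m*n/n≡m k q₁) ⟩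
  k                             ∎
  where
  open ≡-Reasoning
  Q∸q₂<q₁ : Q ∸ q₂ < q₁
  Q∸q₂<q₁ = +-cancelʳ-< q₂ (Q ∸ q₂) q₁ (subst (_< q₁ + q₂) (sym (m∸n+n≡m q₂≤Q)) Q<q₁+q₂)
  Q+q₀≡[Q∸q₂]+kq₁ : Q + q₀ ≡ Q ∸ q₂ + k * q₁
  Q+q₀≡[Q∸q₂]+kq₁ = begin
    Q + q₀               ≡⟨ cong (_+ q₀) (m∸n+n≡m q₂≤Q) ⟨
    Q ∸ q₂ + q₂ + q₀     ≡⟨ +-assoc (Q ∸ q₂) q₂ q₀ ⟩
    Q ∸ q₂ + (q₂ + q₀)   ≡⟨ cong (Q ∸ q₂ +_) (+-comm q₂ q₀) ⟩
    Q ∸ q₂ + (q₀ + q₂)   ≡⟨ cong (Q ∸ q₂ +_) q₀+q₂≡kq₁ ⟩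
    Q ∸ q₂ + k * q₁      ∎

consecutive-recurrence : ∀ {Q a₀ q₀ a₁ q₁ a₂ q₂} → Adjacent a₀ q₀ a₁ q₁ → InF Q a₁ q₁ → InF Q a₂ q₂ →
                         ConsecutiveF Q a₁ q₁ a₂ q₂ →
                         a₀ + a₂ ≡ fdiv (Q + q₀) q₁ * a₁ × q₀ + q₂ ≡ fdiv (Q + q₀) q₁ * q₁
consecutive-recurrence {Q} {a₀} {q₀} {a₁} {q₁} {a₂} {q₂} adj₀₁ a₁/q₁∈F a₂/q₂∈F@(_ , _ , q₂≤Q , _) consec =
  at-ν (adjacent-triple⇒recurrence adj₀₁ (consecutive⇒adjacent a₁/q₁∈F a₂/q₂∈F consec))
  where
  ν : ℕ
  ν = fdiv (Q + q₀) q₁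
  at-ν : (∃ λ k → a₀ + a₂ ≡ k * a₁ × q₀ + q₂ ≡ k * q₁) → a₀ + a₂ ≡ ν * a₁ × q₀ + q₂ ≡ ν * q₁
  at-ν (k , a₀+a₂≡ka₁ , q₀+q₂≡kq₁) = subst (λ m → a₀ + a₂ ≡ m * a₁ × q₀ + q₂ ≡ m * q₁) (sym ν≡k) (a₀+a₂≡ka₁ , q₀+q₂≡kq₁)
    where
    ν≡k : ν ≡ k
    ν≡k = ⌊Q+q₀/q₁⌋≡k (∈F⇒1≤q a₁/q₁∈F) q₂≤Q (consecutive⇒Q<q+t a₁/q₁∈F a₂/q₂∈F consec) q₀+q₂≡kq₁

-- Determinants and K^F

det : ℕ → ℕ → ℕ → ℕ → ℤ
det a q c t = ℤ.+ c ℤ.* ℤ.+ q ℤ.- ℤ.+ a ℤ.* ℤ.+ t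

adjacent⇒det≡1 : ∀ {a q c t} → Adjacent a q c t → det a q c t ≡ 1ℤ
adjacent⇒det≡1 {a} {q} {c} {t} (adjacent cq≡1+at) = begin
  ℤ.+ c ℤ.* ℤ.+ q ℤ.- ℤ.+ a ℤ.* ℤ.+ t   ≡⟨ cong₂ ℤ._-_ (ℤP.pos-* c q) (ℤP.pos-* a t) ⟨
  ℤ.+ (c * q) ℤ.- ℤ.+ (a * t)           ≡⟨ cong (λ z → ℤ.+ z ℤ.- ℤ.+ (a * t)) cq≡1+at ⟩
  ℤ.+ (1 + a * t) ℤ.- ℤ.+ (a * t)       ≡⟨ cong (ℤ._- ℤ.+ (a * t)) (ℤP.pos-+ 1 (a * t)) ⟩
  1ℤ ℤ.+ ℤ.+ (a * t) ℤ.- ℤ.+ (a * t)    ≡⟨ 1+x-x≡1 (ℤ.+ (a * t)) ⟩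
  1ℤ                                    ∎
  where
  open ≡-Reasoning
  1+x-x≡1 : ∀ x → 1ℤ ℤ.+ x ℤ.- x ≡ 1ℤ
  1+x-x≡1 x = ℤ-Solver.solve (x ∷ [])

det-self : ∀ a q → det a q a q ≡ 0ℤ
det-self a q = ℤP.+-inverseʳ (ℤ.+ a ℤ.* ℤ.+ q)

x+z≡ky⇒z≡ky-x : ∀ {x y z} k → x + z ≡ k * y → ℤ.+ z ≡ ℤ.+ k ℤ.* ℤ.+ y ℤ.- ℤ.+ x
x+z≡ky⇒z≡ky-x {x} {y} {z} k x+z≡ky = begin
  ℤ.+ z                              ≡⟨ x+z-x≡z (ℤ.+ x) (ℤ.+ z) ⟨
  ℤ.+ x ℤ.+ ℤ.+ z ℤ.- ℤ.+ x          ≡⟨ cong (ℤ._- ℤ.+ x) (ℤP.pos-+ x z) ⟨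
  ℤ.+ (x + z) ℤ.- ℤ.+ x              ≡⟨ cong (λ w → ℤ.+ w ℤ.- ℤ.+ x) x+z≡ky ⟩
  ℤ.+ (k * y) ℤ.- ℤ.+ x              ≡⟨ cong (ℤ._- ℤ.+ x) (ℤP.pos-* k y) ⟩
  ℤ.+ k ℤ.* ℤ.+ y ℤ.- ℤ.+ x          ∎
  where
  open ≡-Reasoning
  x+z-x≡z : ∀ x z → x ℤ.+ z ℤ.- x ≡ z
  x+z-x≡z x z = ℤ-Solver.solve (x ∷ z ∷ [])

det-recurrence : ∀ {a q c₀ t₀ c₁ t₁ c₂ t₂} k → c₀ + c₂ ≡ k * c₁ → t₀ + t₂ ≡ k * t₁ →
                 det a q c₂ t₂ ≡ ℤ.+ k ℤ.* det a q c₁ t₁ ℤ.- det a q c₀ t₀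
det-recurrence {a} {q} {c₀} {t₀} {c₁} {t₁} {c₂} {t₂} k c-rec t-rec = begin
  ℤ.+ c₂ ℤ.* ℤ.+ q ℤ.- ℤ.+ a ℤ.* ℤ.+ t₂
    ≡⟨ cong₂ (λ c t → c ℤ.* ℤ.+ q ℤ.- ℤ.+ a ℤ.* t) (x+z≡ky⇒z≡ky-x k c-rec) (x+z≡ky⇒z≡ky-x k t-rec) ⟩
  (ℤ.+ k ℤ.* ℤ.+ c₁ ℤ.- ℤ.+ c₀) ℤ.* ℤ.+ q ℤ.- ℤ.+ a ℤ.* (ℤ.+ k ℤ.* ℤ.+ t₁ ℤ.- ℤ.+ t₀)
    ≡⟨ bilinear (ℤ.+ a) (ℤ.+ q) (ℤ.+ c₀) (ℤ.+ t₀) (ℤ.+ c₁) (ℤ.+ t₁) (ℤ.+ k) ⟩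
  ℤ.+ k ℤ.* det a q c₁ t₁ ℤ.- det a q c₀ t₀
    ∎
  where
  open ≡-Reasoning
  bilinear : ∀ a q c₀ t₀ c₁ t₁ k → (k ℤ.* c₁ ℤ.- c₀) ℤ.* q ℤ.- a ℤ.* (k ℤ.* t₁ ℤ.- t₀) ≡
                                   k ℤ.* (c₁ ℤ.* q ℤ.- a ℤ.* t₁) ℤ.- (c₀ ℤ.* q ℤ.- a ℤ.* t₀)
  bilinear a q c₀ t₀ c₁ t₁ k = ℤ-Solver.solve (a ∷ q ∷ c₀ ∷ t₀ ∷ c₁ ∷ t₁ ∷ k ∷ [])

recurrence⇒KF : ∀ (x D : ℕ → ℤ) n → D 0 ≡ 0ℤ → D 1 ≡ 1ℤ →
                (∀ l → 2 + l ≤ n → D (2 + l) ≡ x (suc l) ℤ.* D (suc l) ℤ.- D l) →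
                ∀ l → suc l ≤ n → D (suc l) ≡ KF x l
recurrence⇒KF x D n D0≡0 D1≡1 D-rec = go
  where
  open ≡-Reasoning
  go : ∀ l → suc l ≤ n → D (suc l) ≡ KF x l
  go zero _ = D1≡1
  go (suc zero) 2≤n = begin
    D 2                        ≡⟨ D-rec 0 2≤n ⟩
    x 1 ℤ.* D 1 ℤ.- D 0        ≡⟨ cong₂ (λ u v → x 1 ℤ.* u ℤ.- v) D1≡1 D0≡0 ⟩
    x 1 ℤ.* 1ℤ ℤ.- 0ℤ          ≡⟨ trans (ℤP.+-identityʳ (x 1 ℤ.* 1ℤ)) (ℤP.*-identityʳ (x 1)) ⟩
    x 1                        ∎
  go (suc (suc l)) 3+l≤n = begin
    D (3 + l)                            ≡⟨ D-rec (suc l) 3+l≤n ⟩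
    x (2 + l) ℤ.* D (2 + l) ℤ.- D (1 + l) ≡⟨ cong₂ (λ u v → x (2 + l) ℤ.* u ℤ.- v)
                                                  (go (suc l) (<⇒≤ 3+l≤n)) (go l (<⇒≤ (<⇒≤ 3+l≤n))) ⟩
    KF x (2 + l)                         ∎

-- Chains of consecutive fractions

record FareyChain (Q n : ℕ) (a q : ℕ → ℕ) : Set where
  field
    member      : ∀ i → i ≤ n → InF Q (a i) (q i)
    consecutive : ∀ i → i < n → ConsecutiveF Q (a i) (q i) (a (suc i)) (q (suc i))

module FareyChainProperties {Q : ℕ} where

  tail : ∀ {n a q} → FareyChain Q (suc n) a q → FareyChain Q n (λ i → a (suc i)) (λ i → q (suc i))
  tail chain = record
    { member      = λ i i≤n → member (suc i) (s≤s i≤n)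
    ; consecutive = λ i i<n → consecutive (suc i) (s≤s i<n)
    }
    where open FareyChain chain

  adjacent-links : ∀ {n a q} → FareyChain Q n a q → ∀ i → i < n → Adjacent (a i) (q i) (a (suc i)) (q (suc i))
  adjacent-links chain i i<n = consecutive⇒adjacent (member i (<⇒≤ i<n)) (member (suc i) i<n) (consecutive i i<n)
    where open FareyChain chain

  increasing : ∀ {n a q} → FareyChain Q n a q → 1 ≤ n → a 0 / q 0 <ᶠ a n / q n
  increasing {suc zero} chain _ = proj₁ (FareyChain.consecutive chain 0 (s≤s z≤n))
  increasing {suc (suc n)} {a} {q} chain _ =
    <ᶠ-trans {a 0} {q 0} {a 1} {q 1} {a (2 + n)} {q (2 + n)} (∈F⇒1≤q (member 0 z≤n)) (∈F⇒1≤q (member 1 (s≤s z≤n)))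
             (proj₁ (consecutive 0 (s≤s z≤n))) (increasing (tail chain) (s≤s z≤n))
    where open FareyChain chain

  covers : ∀ {n a q x y} → FareyChain Q n a q → InF Q x y → a 0 / q 0 <ᶠ x / y → x / y <ᶠ a n / q n →
           ∃ λ i → 0 < i × i < n × x ≡ a i × y ≡ q i
  covers {zero} _ _ lower upper = ⊥-elim (<-asym lower upper)
  covers {suc n} {a} {q} chain x/y∈F@(_ , _ , _ , cop-xy) lower upper
    with compare-reduced cop-xy (∈F⇒coprime (member 1 (s≤s z≤n))) (∈F⇒1≤q (member 1 (s≤s z≤n)))
    where open FareyChain chain
  ... | inj₁ x/y<a₁/q₁ = ⊥-elim (proj₂ (FareyChain.consecutive chain 0 (s≤s z≤n)) _ _ x/y∈F (lower , x/y<a₁/q₁))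
  ... | inj₂ (inj₁ (refl , refl)) = 1 , s≤s z≤n , 1<1+n n upper , refl , refl
    where
    1<1+n : ∀ m → a 1 * q (suc m) < a (suc m) * q 1 → 1 < suc m
    1<1+n zero    a₁q₁<a₁q₁ = ⊥-elim (<-irrefl refl a₁q₁<a₁q₁)
    1<1+n (suc _) _         = s≤s (s≤s z≤n)
  ... | inj₂ (inj₂ a₁/q₁<x/y) with i , 0<i , i<n , x≡aᵢ , y≡qᵢ ← covers (tail chain) x/y∈F a₁/q₁<x/y upper =
    suc i , s≤s z≤n , s≤s i<n , x≡aᵢ , y≡qᵢ

  ends-adjacent : ∀ {n a q} → FareyChain Q n a q → 1 ≤ n → 3 ≤ Q → InSF Q (a 0) (q 0) → InSF Q (a n) (q n) →
                  (∀ i → 0 < i → i < n → ¬ InSF Q (a i) (q i)) → Adjacent (a 0) (q 0) (a n) (q n)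
  ends-adjacent {n} chain 1≤n 3≤Q first∈SF last∈SF interior∉SF
    with sf-adjacent-or-between 3≤Q (member 0 z≤n) (member n ≤-refl) first∈SF last∈SF (increasing chain 1≤n)
    where open FareyChain chain
  ... | inj₁ adj = adj
  ... | inj₂ (between x y x/y∈F x/y∈SF lower upper)
    with i , 0<i , i<n , refl , refl ← covers chain x/y∈F lower upper = ⊥-elim (interior∉SF i 0<i i<n x/y∈SF)

  det≡KF : ∀ {n a q} → FareyChain Q n a q → (ν : ℕ → ℤ) → (∀ l → ν (suc l) ≡ ℤ.+ fdiv (Q + q l) (q (suc l))) →
           ∀ l → suc l ≤ n → det (a 0) (q 0) (a (suc l)) (q (suc l)) ≡ KF ν l
  det≡KF {n} {a} {q} chain ν ν-def l 1+l≤n =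
    recurrence⇒KF ν D n (det-self (a 0) (q 0)) (adjacent⇒det≡1 (adjacent-links chain 0 (≤-trans (s≤s z≤n) 1+l≤n)))
                  D-rec l 1+l≤n
    where
    open FareyChain chain
    D : ℕ → ℤ
    D i = det (a 0) (q 0) (a i) (q i)
    D-rec : ∀ l → 2 + l ≤ n → D (2 + l) ≡ ν (suc l) ℤ.* D (suc l) ℤ.- D l
    D-rec l 2+l≤n = subst (λ m → D (2 + l) ≡ m ℤ.* D (suc l) ℤ.- D l) (sym (ν-def l))
                          (det-recurrence {a 0} {q 0} {a l} {q l} {a (1 + l)} {q (1 + l)} {a (2 + l)} {q (2 + l)}
                                          (fdiv (Q + q l) (q (suc l))) (proj₁ recurrence) (proj₂ recurrence))
      where
      recurrence : a l + a (2 + l) ≡ fdiv (Q + q l) (q (suc l)) * a (1 + l) ×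
                   q l + q (2 + l) ≡ fdiv (Q + q l) (q (suc l)) * q (1 + l)
      recurrence = consecutive-recurrence (adjacent-links chain l (<⇒≤ 2+l≤n)) (member (suc l) (<⇒≤ 2+l≤n))
                                          (member (2 + l) 2+l≤n) (consecutive (suc l) 2+l≤n)

open FareyChainProperties

lemma5 : (Q r : ℕ) → 3 ≤ Q → 1 ≤ r → (a q : ℕ → ℕ) →
         (∀ i → 1 ≤ i → i ≤ r + 1 → InF Q (a i) (q i)) →
         (∀ i → 1 ≤ i → i ≤ r → ConsecutiveF Q (a i) (q i) (a (suc i)) (q (suc i))) →
         InSF Q (a 1) (q 1) →
         InSF Q (a (r + 1)) (q (r + 1)) →
         (∀ i → 2 ≤ i → i ≤ r → ¬ InSF Q (a i) (q i)) →
         KF (λ j → ℤ.+ fdiv (Q + q j) (q (suc j))) (r ∸ 1) ≡ ℤ.+ 1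
lemma5 Q r 3≤Q 1≤r a q ∈F consecutive first∈SF last∈SF interior∉SF = begin
  KF ν (r ∸ 1)     ≡⟨ det≡KF chain ν (λ _ → refl) (r ∸ 1) (≤-reflexive 1+[r∸1]≡r) ⟨
  D (suc (r ∸ 1))  ≡⟨ cong D 1+[r∸1]≡r ⟩
  D r              ≡⟨ adjacent⇒det≡1 (ends-adjacent chain 1≤r 3≤Q first∈SF last∈SF′ interior∉SF′) ⟩
  1ℤ               ∎
  where
  open ≡-Reasoning
  ν : ℕ → ℤ
  ν j = ℤ.+ fdiv (Q + q j) (q (suc j))
  D : ℕ → ℤ
  D i = det (a 1) (q 1) (a (suc i)) (q (suc i))
  1+[r∸1]≡r : suc (r ∸ 1) ≡ r
  1+[r∸1]≡r = m+[n∸m]≡n 1≤r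
  chain : FareyChain Q r (λ i → a (suc i)) (λ i → q (suc i))
  chain = record
    { member      = λ i i≤r → ∈F (suc i) (s≤s z≤n) (≤-trans (s≤s i≤r) (≤-reflexive (+-comm 1 r)))
    ; consecutive = λ i i<r → consecutive (suc i) (s≤s z≤n) i<r
    }
  last∈SF′ : InSF Q (a (suc r)) (q (suc r))
  last∈SF′ = subst (λ i → InSF Q (a i) (q i)) (+-comm r 1) last∈SF
  interior∉SF′ : ∀ i → 0 < i → i < r → ¬ InSF Q (a (suc i)) (q (suc i))
  interior∉SF′ i 0<i i<r = interior∉SF (suc i) (s≤s 0<i) i<r
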